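{- For every positive integer $n$, the number $f_0(\mathcal{L}_n)$ of vertices of $\mathcal{L}_n$ satisfies $$f_0(\mathcal{L}_n)\le \sum_{k=n^2}^{3n^2-3n+1}\binom{n^3}{k}.$$
   Context: $\mathcal{L}_n\subset\mathbb{R}^{n^3}$ is the polytope of $n\times n\times n$ line-stochastic tensors: real arrays $A=(a_{ijk})$, $1\le i,j,k\le n$, with $a_{ijk}\ge 0$, $\sum_i a_{ijk}=1$ for all $j,k$, $\sum_j a_{ijk}=1$ for all $i,k$, and $\sum_k a_{ijk}=1$ for all $i,j$.
   Formalization: The tensors in $\mathcal{L}_n$ have rational entries rather than real ones, and vertices are extreme points with respect to rational convex combinations of rational tensors. -}

module Defs where

open import Data.Nat using (ℕ; zero; suc; _∸_; _^_) renaming (_+_ to _+ℕ_; _*_ to _*ℕ_)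
open import Data.Nat.Combinatorics using (_C_)
open import Data.Fin using (Fin; zero; suc)
open import Data.List using (List; map; upTo)
open import Data.Nat.ListAction using (sum)
open import Data.Rational using (ℚ; 0ℚ; 1ℚ; _+_; _*_; _-_; _≤_; _<_)
open import Data.Product using (_×_)
open import Relation.Binary.PropositionalEquality using (_≡_)

Σℚ : (n : ℕ) → (Fin n → ℚ) → ℚ
Σℚ zero    f = 0ℚ
Σℚ (suc n) f = f zero + Σℚ n (λ i → f (suc i))

-- real-valued n×n×n arrays, with rational entries
Tensor : ℕ → Set
Tensor n = Fin n → Fin n → Fin n → ℚ

_≐_ : {n : ℕ} → Tensor n → Tensor n → Set
_≐_ {n} A B = ∀ (i j k : Fin n) → A i j k ≡ B i j k

LineStochastic : (n : ℕ) → Tensor n → Set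
LineStochastic n A =
  (∀ i j k → 0ℚ ≤ A i j k) ×
  (∀ j k → Σℚ n (λ i → A i j k) ≡ 1ℚ) ×
  (∀ i k → Σℚ n (λ j → A i j k) ≡ 1ℚ) ×
  (∀ i j → Σℚ n (λ k → A i j k) ≡ 1ℚ)

IsVertex : (n : ℕ) → Tensor n → Set
IsVertex n A =
  LineStochastic n A ×
  (∀ (B C : Tensor n) (t : ℚ) →
     LineStochastic n B → LineStochastic n C →
     0ℚ < t → t < 1ℚ →
     A ≐ (λ i j k → t * B i j k + (1ℚ - t) * C i j k) →
     (B ≐ A) × (C ≐ A))

-- Σ_{k=a}^{b} f k  (empty when b < a)
sumFromTo : ℕ → ℕ → (ℕ → ℕ) → ℕ
sumFromTo a b f = sum (map (λ k → f (a +ℕ k)) (upTo (suc b ∸ a)))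

vertexBound : ℕ → ℕ
vertexBound n = sumFromTo (n ^ 2) ((3 *ℕ n ^ 2 ∸ 3 *ℕ n) +ℕ 1) (λ k → (n ^ 3) C k)

-- A vertex A of L_n is determined by its support: if X has zero line sums and vanishes outside
-- the support of A, then A ± εX lie in L_n for small ε > 0 and average to A, so X = 0. Hence
-- distinct vertices have distinct supports among the n³ cells, and it suffices to bound their
-- sizes. Every line contains a nonzero entry, so a support has at least n² cells. The
-- 3n² - 3n + 1 line sums along i, along j with i ≠ 0, and along k with i, j ≠ 0 imply all the
-- others; on a larger support some nonzero X would satisfy them, contradicting the rigidity
-- above. Counting subsets of each admissible size gives the bound.

{-# OPTIONS --safe #-}
module Submission where

open import Defs
open import Data.Nat using (ℕ; _≤_)
open import Data.List using (List; length)
open import Data.List.Relation.Unary.All using (All)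
open import Data.List.Relation.Unary.AllPairs using (AllPairs)
open import Relation.Nullary using (¬_)

import Algebra.Properties.CommutativeMonoid.Sum as CommutativeMonoidSum
import Algebra.Properties.Semiring.Sum as SemiringSum
open import Algebra.Bundles using (CommutativeRing)
open import Data.Fin using (Fin; zero; suc; _≟_; combine; remQuot)
open import Data.Fin.Properties using (combine-remQuot; remQuot-combine; ¬∀⟶∃¬)
open import Data.Fin.Subset using (Subset; Side; inside; outside; _∈_; _∉_; _⊆_; _-_; ⁅_⁆; ∣_∣; Nonempty)
open import Data.Fin.Subset.Properties using (p─⊥≡p; p─q⊆p; x∈p⇒∣p-x∣<∣p∣)
open import Data.List using (_∷_; []; _++_; map; tabulate; filter; upTo)
open import Data.List.Properties using (length-++; length-tabulate; length-map; map-++; upTo-∷ʳ)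
open import Data.List.Relation.Unary.All using (_∷_; [])
import Data.List.Relation.Unary.All as All
import Data.List.Relation.Unary.All.Properties as All
open import Data.List.Relation.Unary.AllPairs using (_∷_; [])
import Data.List.Relation.Unary.AllPairs.Properties as AllPairs
open import Data.List.Relation.Unary.Unique.Propositional using (Unique)
open import Data.Nat using (zero; suc; _<_; _∸_; _^_; z≤n; s≤s) renaming (_+_ to _+ℕ_; _*_ to _*ℕ_)
import Data.Nat.Properties as ℕ
open import Data.Nat.Combinatorics using (_C_; nCk+nC[k+1]≡[n+1]C[k+1])
open import Data.Nat.ListAction using (sum)
open import Data.Nat.ListAction.Properties using (sum-++)
open import Data.Nat.Tactic.RingSolver using () renaming (solve-∀ to ℕ-solve-∀)
open import Data.Product using (_×_; _,_; proj₁; proj₂; ∃-syntax; uncurry)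
import Data.Product as Product
open import Data.Rational using (ℚ; 0ℚ; 1ℚ; ½; _+_; _*_; -_; 1/_; _⊓_)
  renaming (_≤_ to _≤ℚ_; _<_ to _<ℚ_)
import Data.Rational as ℚ
import Data.Rational.Properties as ℚ
open import Data.Sum using (inj₁; inj₂)
open import Data.Vec using (Vec; _∷_; []; here; there; lookup; concat) renaming (tabulate to tabulateVec)
import Data.Vec as Vec
open import Data.Vec.Properties using (lookup-concat; lookup∘tabulate; []=⇒lookup; lookup⇒[]=)
open import Data.Vec.Functional using (Vector)
open import Function using (_∘_)
open import Level using (0ℓ)
open import Relation.Binary.PropositionalEquality
open import Relation.Nullary using (Dec; yes; no; does; contradiction)
import Data.Bool as Bool
open import Relation.Nullary.Decidable using (dec⇒maybe; from-yes)
open import Relation.Unary.Properties using (∁?)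
import Tactic.RingSolver.Core.AlmostCommutativeRing as ACR
open import Tactic.RingSolver using (solve-∀)

ℚ-ring : ACR.AlmostCommutativeRing 0ℓ 0ℓ
ℚ-ring = ACR.fromCommutativeRing ℚ.+-*-commutativeRing (λ x → dec⇒maybe (0ℚ ℚ.≟ x))

private
  module ∑ = CommutativeMonoidSum ℚ.+-0-commutativeMonoid
  module ∑* = SemiringSum (CommutativeRing.semiring ℚ.+-*-commutativeRing)

Σℚ≡sum : ∀ n (f : Fin n → ℚ) → Σℚ n f ≡ ∑.sum f
Σℚ≡sum zero    f = refl
Σℚ≡sum (suc n) f = cong (f zero +_) (Σℚ≡sum n (f ∘ suc))

Σℚ-linear : ∀ n a b (f g : Fin n → ℚ) →
  Σℚ n (λ i → a * f i + b * g i) ≡ a * Σℚ n f + b * Σℚ n g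
Σℚ-linear n a b f g = begin
  Σℚ n (λ i → a * f i + b * g i)                ≡⟨ Σℚ≡sum n _ ⟩
  ∑.sum (λ i → a * f i + b * g i)               ≡⟨ ∑.∑-distrib-+ (λ i → a * f i) (λ i → b * g i) ⟩
  ∑.sum (λ i → a * f i) + ∑.sum (λ i → b * g i) ≡⟨ cong₂ _+_ (∑*.*-distribˡ-sum a f) (∑*.*-distribˡ-sum b g) ⟨
  a * ∑.sum f + b * ∑.sum g                     ≡⟨ cong₂ (λ s t → a * s + b * t) (Σℚ≡sum n f) (Σℚ≡sum n g) ⟨
  a * Σℚ n f + b * Σℚ n g                       ∎
  where open ≡-Reasoning

Σℚ-zero : ∀ n {f : Fin n → ℚ} → (∀ i → f i ≡ 0ℚ) → Σℚ n f ≡ 0ℚ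
Σℚ-zero n {f} f≡0 = trans (Σℚ≡sum n f) (trans (∑.sum-cong-≗ f≡0) (∑.sum-replicate-zero n))

Σℚ-comm : ∀ m n (f : Fin m → Fin n → ℚ) →
  Σℚ m (λ i → Σℚ n (f i)) ≡ Σℚ n (λ j → Σℚ m (λ i → f i j))
Σℚ-comm m n f = begin
  Σℚ m (λ i → Σℚ n (f i))                ≡⟨ Σℚ≡sum m _ ⟩
  ∑.sum (λ i → Σℚ n (f i))               ≡⟨ ∑.sum-cong-≗ (λ i → Σℚ≡sum n (f i)) ⟩
  ∑.sum (λ i → ∑.sum (f i))              ≡⟨ ∑.∑-comm f ⟩
  ∑.sum (λ j → ∑.sum (λ i → f i j))      ≡⟨ ∑.sum-cong-≗ (λ j → Σℚ≡sum m (λ i → f i j)) ⟨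
  ∑.sum (λ j → Σℚ m (λ i → f i j))       ≡⟨ Σℚ≡sum n _ ⟨
  Σℚ n (λ j → Σℚ m (λ i → f i j))        ∎
  where open ≡-Reasoning

Σℚ≢0⇒nonzero-term : ∀ n {f : Fin n → ℚ} → Σℚ n f ≢ 0ℚ → ∃[ k ] f k ≢ 0ℚ
Σℚ≢0⇒nonzero-term n {f} Σ≢0 = ¬∀⟶∃¬ n (λ k → f k ≡ 0ℚ) (λ k → f k ℚ.≟ 0ℚ) (Σ≢0 ∘ Σℚ-zero n)

p*q≡0⇒q≡0 : ∀ {p q} → p ≢ 0ℚ → p * q ≡ 0ℚ → q ≡ 0ℚ
p*q≡0⇒q≡0 {p} {q} p≢0 pq≡0 = begin
  q              ≡⟨ ℚ.*-identityˡ q ⟨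
  1ℚ * q         ≡⟨ cong (_* q) (ℚ.*-inverseˡ p) ⟨
  1/ p * p * q   ≡⟨ ℚ.*-assoc (1/ p) p q ⟩
  1/ p * (p * q) ≡⟨ cong (1/ p *_) pq≡0 ⟩
  1/ p * 0ℚ      ≡⟨ ℚ.*-zeroʳ (1/ p) ⟩
  0ℚ             ∎
  where
  open ≡-Reasoning
  instance
    _ : ℚ.NonZero p
    _ = ℚ.≢-nonZero p≢0

∣y∣≤a⇒0≤a+y : ∀ {a y} → ℚ.∣ y ∣ ≤ℚ a → 0ℚ ≤ℚ a + y
∣y∣≤a⇒0≤a+y {a} {y} ∣y∣≤a with ℚ.∣p∣≡p∨∣p∣≡-p y
... | inj₁ ∣y∣≡y  = subst (_≤ℚ a + y) (ℚ.+-identityʳ 0ℚ)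
  (ℚ.+-mono-≤ (ℚ.≤-trans (ℚ.0≤∣p∣ y) ∣y∣≤a) (subst (0ℚ ≤ℚ_) ∣y∣≡y (ℚ.0≤∣p∣ y)))
... | inj₂ ∣y∣≡-y = subst (_≤ℚ a + y) (ℚ.+-inverseˡ y) (ℚ.+-monoˡ-≤ y (subst (_≤ℚ a) ∣y∣≡-y ∣y∣≤a))

a*0+b*0≡0 : ∀ a b → a * 0ℚ + b * 0ℚ ≡ 0ℚ
a*0+b*0≡0 a b = trans (cong₂ _+_ (ℚ.*-zeroʳ a) (ℚ.*-zeroʳ b)) (ℚ.+-identityʳ 0ℚ)

⊓-positive : ∀ {p q} → 0ℚ <ℚ p → 0ℚ <ℚ q → 0ℚ <ℚ p ⊓ q
⊓-positive {p} {q} 0<p 0<q with ℚ.⊓-sel p q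
... | inj₁ p⊓q≡p = subst (0ℚ <ℚ_) (sym p⊓q≡p) 0<p
... | inj₂ p⊓q≡q = subst (0ℚ <ℚ_) (sym p⊓q≡q) 0<q

∣p∣≤1+∣p-x∣ : ∀ {N} (p : Subset N) x → ∣ p ∣ ≤ suc ∣ p - x ∣
∣p∣≤1+∣p-x∣ (inside  ∷ p) zero    = s≤s (ℕ.≤-reflexive (cong ∣_∣ (sym (p─⊥≡p p))))
∣p∣≤1+∣p-x∣ (outside ∷ p) zero    = ℕ.m≤n⇒m≤1+n (ℕ.≤-reflexive (cong ∣_∣ (sym (p─⊥≡p p))))
∣p∣≤1+∣p-x∣ (inside  ∷ p) (suc x) = s≤s (∣p∣≤1+∣p-x∣ p x)
∣p∣≤1+∣p-x∣ (outside ∷ p) (suc x) = ∣p∣≤1+∣p-x∣ p x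

x∉p-x : ∀ {N} {p : Subset N} {x} → x ∉ p - x
x∉p-x {p = _ ∷ p} {suc x} (there x∈p-x) = x∉p-x x∈p-x

∣p∣>0⇒Nonempty : ∀ {N} (p : Subset N) → 0 < ∣ p ∣ → Nonempty p
∣p∣>0⇒Nonempty (inside  ∷ p) _   = zero , here
∣p∣>0⇒Nonempty (outside ∷ p) ∣p∣>0 = Product.map suc there (∣p∣>0⇒Nonempty p ∣p∣>0)

x∈p⇒∣p∣>0 : ∀ {m} {p : Subset m} {x} → x ∈ p → 0 < ∣ p ∣
x∈p⇒∣p∣>0 x∈p = ℕ.<-≤-trans (s≤s z≤n) (x∈p⇒∣p-x∣<∣p∣ x∈p)

∣p++q∣ : ∀ {m k} (p : Subset m) (q : Subset k) → ∣ p Vec.++ q ∣ ≡ ∣ p ∣ +ℕ ∣ q ∣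
∣p++q∣ []            q = refl
∣p++q∣ (inside  ∷ p) q = cong suc (∣p++q∣ p q)
∣p++q∣ (outside ∷ p) q = ∣p++q∣ p q

∣concat∣-lower : ∀ {k m c} (f : Fin k → Subset m) → (∀ i → c ≤ ∣ f i ∣) →
  k *ℕ c ≤ ∣ concat (tabulateVec f) ∣
∣concat∣-lower {zero}  f c≤ = z≤n
∣concat∣-lower {suc k} f c≤ = ℕ.≤-trans
  (ℕ.+-mono-≤ (c≤ zero) (∣concat∣-lower (f ∘ suc) (c≤ ∘ suc)))
  (ℕ.≤-reflexive (sym (∣p++q∣ (f zero) (concat (tabulateVec (f ∘ suc))))))

record LinearForm (N : ℕ) : Set where
  field
    apply  : Vector ℚ N → ℚ
    linear : ∀ a b x y → apply (λ p → a * x p + b * y p) ≡ a * apply x + b * apply y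

open LinearForm

Supported : ∀ {N} → Subset N → Vector ℚ N → Set
Supported s x = ∀ p → x p ≢ 0ℚ → p ∈ s

supported-mono : ∀ {N} {s t : Subset N} {x} → s ⊆ t → Supported s x → Supported t x
supported-mono s⊆t x⊆s p x[p]≢0 = s⊆t (x⊆s p x[p]≢0)

supported-∉ : ∀ {N} {s : Subset N} {x} → Supported s x → ∀ {p} → p ∉ s → x p ≡ 0ℚ
supported-∉ {x = x} x⊆s {p} p∉s with x p ℚ.≟ 0ℚ
... | yes x[p]≡0 = x[p]≡0
... | no  x[p]≢0 = contradiction (x⊆s p x[p]≢0) p∉s

Nontrivial : ∀ {N} → Vector ℚ N → Set
Nontrivial x = ∃[ p ] x p ≢ 0ℚ

Annihilates : ∀ {N} → List (LinearForm N) → Vector ℚ N → Set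
Annihilates φs x = All (λ φ → apply φ x ≡ 0ℚ) φs

unit : ∀ {N} → Fin N → Vector ℚ N
unit q p with p ≟ q
... | yes _ = 1ℚ
... | no  _ = 0ℚ

unit-supported : ∀ {N} {s : Subset N} {q} → q ∈ s → Supported s (unit q)
unit-supported {q = q} q∈s p uq[p]≢0 with p ≟ q
... | yes refl = q∈s
... | no  _    = contradiction refl uq[p]≢0

unit-self : ∀ {N} (q : Fin N) → unit q q ≡ 1ℚ
unit-self q with q ≟ q
... | yes _   = refl
... | no  q≢q = contradiction refl q≢q

unit-nontrivial : ∀ {N} (q : Fin N) → Nontrivial (unit q)
unit-nontrivial q = q , λ uq[q]≡0 → ℚ.1≢0 (trans (sym (unit-self q)) uq[q]≡0)

combination-supported : ∀ {N} {s : Subset N} {y z} a b →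
  Supported s y → Supported s z → Supported s (λ p → a * y p + b * z p)
combination-supported {y = y} {z} a b y⊆s z⊆s p ≢0 with y p ℚ.≟ 0ℚ | z p ℚ.≟ 0ℚ
... | no  y[p]≢0 | _          = y⊆s p y[p]≢0
... | yes _      | no z[p]≢0  = z⊆s p z[p]≢0
... | yes y[p]≡0 | yes z[p]≡0 =
  contradiction (trans (cong₂ (λ u v → a * u + b * v) y[p]≡0 z[p]≡0) (a*0+b*0≡0 a b)) ≢0

combination-annihilated : ∀ {N} (φs : List (LinearForm N)) {y z} a b →
  Annihilates φs y → Annihilates φs z → Annihilates φs (λ p → a * y p + b * z p)
combination-annihilated {N} φs {y} {z} a b φs[y]≡0 φs[z]≡0 =
  All.zipWith (λ {φ} → vanish {φ}) (φs[y]≡0 , φs[z]≡0)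
  where
  vanish : ∀ {φ : LinearForm N} → apply φ y ≡ 0ℚ × apply φ z ≡ 0ℚ → apply φ (λ p → a * y p + b * z p) ≡ 0ℚ
  vanish {φ} (φ[y]≡0 , φ[z]≡0) = begin
    apply φ (λ p → a * y p + b * z p)   ≡⟨ linear φ a b y z ⟩
    a * apply φ y + b * apply φ z       ≡⟨ cong₂ (λ u v → a * u + b * v) φ[y]≡0 φ[z]≡0 ⟩
    a * 0ℚ + b * 0ℚ                     ≡⟨ a*0+b*0≡0 a b ⟩
    0ℚ                                  ∎
    where open ≡-Reasoning

-- Induction on the forms: if y and z solve φs and z vanishes at a point p where y does not,
-- then either z also solves φ, or φ(z) y - φ(y) z does and is nonzero at p.
nontrivial-solution : ∀ {N} (φs : List (LinearForm N)) (s : Subset N) → length φs < ∣ s ∣ →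
  ∃[ x ] Supported s x × Nontrivial x × Annihilates φs x
nontrivial-solution [] s ∣s∣>0 =
  let q , q∈s = ∣p∣>0⇒Nonempty s ∣s∣>0 in
  unit q , unit-supported q∈s , unit-nontrivial q , []
nontrivial-solution (φ ∷ φs) s φs<∣s∣
  with nontrivial-solution φs s (ℕ.<⇒≤ φs<∣s∣)
... | y , y⊆s , (p , y[p]≢0) , φs[y]≡0
  with nontrivial-solution φs (s - p) (ℕ.≤-pred (ℕ.≤-trans φs<∣s∣ (∣p∣≤1+∣p-x∣ s p)))
... | z , z⊆s-p , z≢0 , φs[z]≡0
  with apply φ z ℚ.≟ 0ℚ
... | yes φ[z]≡0 = z , supported-mono (p─q⊆p s ⁅ p ⁆) z⊆s-p , z≢0 , φ[z]≡0 ∷ φs[z]≡0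
... | no  φ[z]≢0 =
  x , combination-supported a b y⊆s (supported-mono (p─q⊆p s ⁅ p ⁆) z⊆s-p) , (p , x[p]≢0) ,
  φ[x]≡0 ∷ combination-annihilated φs a b φs[y]≡0 φs[z]≡0
  where
  a b : ℚ
  a = apply φ z
  b = - apply φ y
  x : Vector ℚ _
  x q = a * y q + b * z q
  x[p]≢0 : x p ≢ 0ℚ
  x[p]≢0 x[p]≡0 = y[p]≢0 (p*q≡0⇒q≡0 φ[z]≢0 (begin
    a * y p            ≡⟨ ℚ.+-identityʳ _ ⟨
    a * y p + 0ℚ       ≡⟨ cong (a * y p +_) (ℚ.*-zeroʳ b) ⟨
    a * y p + b * 0ℚ   ≡⟨ cong (λ v → a * y p + b * v) (supported-∉ z⊆s-p x∉p-x) ⟨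
    x p                ≡⟨ x[p]≡0 ⟩
    0ℚ                 ∎))
    where open ≡-Reasoning
  φ[x]≡0 : apply φ x ≡ 0ℚ
  φ[x]≡0 = trans (linear φ a b y z) (cancel (apply φ z) (apply φ y))
    where
    cancel : ∀ u v → u * v + (- v) * u ≡ 0ℚ
    cancel = solve-∀ ℚ-ring

length-filter-∁ : ∀ {A : Set} {P : A → Set} (P? : ∀ x → Dec (P x)) (xs : List A) →
  length xs ≡ length (filter P? xs) +ℕ length (filter (∁? P?) xs)
length-filter-∁ P? []       = refl
length-filter-∁ P? (x ∷ xs) with P? x
... | yes _ = cong suc (length-filter-∁ P? xs)
... | no  _ = trans (cong suc (length-filter-∁ P? xs)) (sym (ℕ.+-suc _ _))

sum-map-upTo-suc : ∀ (g : ℕ → ℕ) d → sum (map g (upTo (suc d))) ≡ sum (map g (upTo d)) +ℕ g d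
sum-map-upTo-suc g d = begin
  sum (map g (upTo (suc d)))                 ≡⟨ cong (sum ∘ map g) (upTo-∷ʳ d) ⟨
  sum (map g (upTo d ++ d ∷ []))             ≡⟨ cong sum (map-++ g (upTo d) (d ∷ [])) ⟩
  sum (map g (upTo d) ++ g d ∷ [])           ≡⟨ sum-++ (map g (upTo d)) (g d ∷ []) ⟩
  sum (map g (upTo d)) +ℕ (g d +ℕ 0)         ≡⟨ cong (sum (map g (upTo d)) +ℕ_) (ℕ.+-identityʳ (g d)) ⟩
  sum (map g (upTo d)) +ℕ g d                ∎
  where open ≡-Reasoning

AllPairs-map-under-All : ∀ {A : Set} {P : A → Set} {R S : A → A → Set} →
  (∀ {x y} → P x → P y → R x y → S x y) → ∀ {xs} → All P xs → AllPairs R xs → AllPairs S xs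
AllPairs-map-under-All f []         []         = []
AllPairs-map-under-All f (px ∷ pxs) (rs ∷ rss) =
  All.zipWith (λ (py , r) → f px py r) (pxs , rs) ∷ AllPairs-map-under-All f pxs rss

tailsWithHead : ∀ {N} → Side → List (Subset (suc N)) → List (Subset N)
tailsWithHead x []             = []
tailsWithHead x ((y ∷ p) ∷ ps) with x Bool.≟ y
... | yes _ = p ∷ tailsWithHead x ps
... | no  _ = tailsWithHead x ps

length-tailsWithHead : ∀ {N} (ps : List (Subset (suc N))) →
  length ps ≡ length (tailsWithHead inside ps) +ℕ length (tailsWithHead outside ps)
length-tailsWithHead []                   = refl
length-tailsWithHead ((inside  ∷ p) ∷ ps) = cong suc (length-tailsWithHead ps)
length-tailsWithHead ((outside ∷ p) ∷ ps) =
  trans (cong suc (length-tailsWithHead ps)) (sym (ℕ.+-suc _ _))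

tailsWithHead⁺ : ∀ {N} {P : Subset (suc N) → Set} {x} {ps} →
  All P ps → All (P ∘ (x ∷_)) (tailsWithHead x ps)
tailsWithHead⁺ []                                   = []
tailsWithHead⁺ {x = x} {(y ∷ p) ∷ ps} (Pyp ∷ Pps) with x Bool.≟ y
... | yes refl = Pyp ∷ tailsWithHead⁺ Pps
... | no  _    = tailsWithHead⁺ Pps

tailsWithHead-unique : ∀ {N} {x} {ps : List (Subset (suc N))} →
  Unique ps → Unique (tailsWithHead x ps)
tailsWithHead-unique                    []             = []
tailsWithHead-unique {x = x} {(y ∷ p) ∷ ps} (yp∉ps ∷ u) with x Bool.≟ y
... | yes refl = All.map (λ ne eq → ne (cong (x ∷_) eq)) (tailsWithHead⁺ yp∉ps) ∷ tailsWithHead-unique u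
... | no  _    = tailsWithHead-unique u

unique-subsets-of-size : ∀ {N} k {ps : List (Subset N)} →
  All (λ p → ∣ p ∣ ≡ k) ps → Unique ps → length ps ≤ N C k
unique-subsets-of-size {zero}  _       {[]}           _        _                 = z≤n
unique-subsets-of-size {zero}  zero    {[] ∷ []}      _        _                 = ℕ.≤-refl
unique-subsets-of-size {zero}  zero    {[] ∷ [] ∷ _}  _        ((≢ ∷ _) ∷ _)     = contradiction refl ≢
unique-subsets-of-size {zero}  (suc k) {[] ∷ _}       (() ∷ _) _
unique-subsets-of-size {suc N} zero    {ps}           sizes    u                 = begin
  length ps                       ≡⟨ length-tailsWithHead ps ⟩
  length ins +ℕ length outs       ≤⟨ ℕ.+-mono-≤ (no-insides (tailsWithHead⁺ sizes))
                                         (unique-subsets-of-size zero (tailsWithHead⁺ sizes) (tailsWithHead-unique u)) ⟩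
  0 +ℕ N C 0                      ∎
  where
  open ℕ.≤-Reasoning
  ins outs : List (Subset N)
  ins = tailsWithHead inside ps
  outs = tailsWithHead outside ps
  no-insides : ∀ {qs} → All (λ p → ∣ inside ∷ p ∣ ≡ 0) qs → length qs ≤ 0
  no-insides []      = z≤n
  no-insides (() ∷ _)
unique-subsets-of-size {suc N} (suc k) {ps}           sizes    u                 = begin
  length ps                       ≡⟨ length-tailsWithHead ps ⟩
  length ins +ℕ length outs       ≤⟨ ℕ.+-mono-≤
                                       (unique-subsets-of-size k (All.map ℕ.suc-injective (tailsWithHead⁺ sizes)) (tailsWithHead-unique u))
                                       (unique-subsets-of-size (suc k) (tailsWithHead⁺ sizes) (tailsWithHead-unique u)) ⟩
  N C k +ℕ N C suc k              ≡⟨ nCk+nC[k+1]≡[n+1]C[k+1] N k ⟩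
  suc N C suc k                   ∎
  where
  open ℕ.≤-Reasoning
  ins outs : List (Subset N)
  ins = tailsWithHead inside ps
  outs = tailsWithHead outside ps

unique-subsets-of-sizes : ∀ {N} a d {ps : List (Subset N)} →
  All (λ p → a ≤ ∣ p ∣ × ∣ p ∣ < a +ℕ d) ps → Unique ps →
  length ps ≤ sum (map (λ k → N C (a +ℕ k)) (upTo d))
unique-subsets-of-sizes a zero    {[]}    _               _ = z≤n
unique-subsets-of-sizes a zero    {p ∷ _} ((a≤ , <a) ∷ _) _ =
  contradiction (ℕ.≤-<-trans a≤ (subst (∣ p ∣ <_) (ℕ.+-identityʳ a) <a)) (ℕ.<-irrefl refl)
unique-subsets-of-sizes {N} a (suc d) {ps} sizes u = begin
  length ps                                    ≡⟨ length-filter-∁ top? ps ⟩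
  length tops +ℕ length rest                   ≤⟨ ℕ.+-mono-≤
                                                    (unique-subsets-of-size (a +ℕ d) (All.all-filter top? ps) (AllPairs.filter⁺ top? u))
                                                    (unique-subsets-of-sizes a d rest-sizes (AllPairs.filter⁺ (∁? top?) u)) ⟩
  N C (a +ℕ d) +ℕ sum (map g (upTo d))         ≡⟨ ℕ.+-comm (N C (a +ℕ d)) _ ⟩
  sum (map g (upTo d)) +ℕ N C (a +ℕ d)         ≡⟨ sum-map-upTo-suc g d ⟨
  sum (map g (upTo (suc d)))                   ∎
  where
  open ℕ.≤-Reasoning
  g : ℕ → ℕ
  g k = N C (a +ℕ k)
  top? : ∀ p → Dec (∣ p ∣ ≡ a +ℕ d)
  top? p = ∣ p ∣ ℕ.≟ a +ℕ d
  tops rest : List (Subset N)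
  tops = filter top? ps
  rest = filter (∁? top?) ps
  lower-size : ∀ {p} → (a ≤ ∣ p ∣ × ∣ p ∣ < a +ℕ suc d) × ∣ p ∣ ≢ a +ℕ d → a ≤ ∣ p ∣ × ∣ p ∣ < a +ℕ d
  lower-size {p} ((a≤ , <a+1+d) , ≢a+d) =
    a≤ , ℕ.≤∧≢⇒< (ℕ.≤-pred (subst (∣ p ∣ <_) (ℕ.+-suc a d) <a+1+d)) ≢a+d
  rest-sizes : All (λ p → a ≤ ∣ p ∣ × ∣ p ∣ < a +ℕ d) rest
  rest-sizes = All.zipWith (λ {p} → lower-size {p}) (All.filter⁺ (∁? top?) sizes , All.all-filter (∁? top?) ps)

unique-subsets-sized-within : ∀ {N} a b {ps : List (Subset N)} →
  All (λ p → a ≤ ∣ p ∣ × ∣ p ∣ ≤ b) ps → Unique ps → length ps ≤ sumFromTo a b (N C_)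
unique-subsets-sized-within a b sizes =
  unique-subsets-of-sizes a (suc b ∸ a) (All.map (λ {p} → within {p}) sizes)
  where
  within : ∀ {p} → a ≤ ∣ p ∣ × ∣ p ∣ ≤ b → a ≤ ∣ p ∣ × ∣ p ∣ < a +ℕ (suc b ∸ a)
  within {p} (a≤ , ≤b) =
    a≤ , subst (∣ p ∣ <_) (sym (ℕ.m+[n∸m]≡n (ℕ.m≤n⇒m≤1+n (ℕ.≤-trans a≤ ≤b)))) (s≤s ≤b)

cube : ℕ → ℕ
cube n = n *ℕ (n *ℕ n)

position : ∀ {n} → Fin n → Fin n → Fin n → Fin (cube n)
position i j k = combine i (combine j k)

position-surjective : ∀ {n} (p : Fin (cube n)) → ∃[ i ] ∃[ j ] ∃[ k ] position i j k ≡ p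
position-surjective {n} p =
  i , j , k , trans (cong (combine i) (combine-remQuot {n} n r)) (combine-remQuot {n} (n *ℕ n) p)
  where
  i : Fin n
  i = proj₁ (remQuot {n} (n *ℕ n) p)
  r : Fin (n *ℕ n)
  r = proj₂ (remQuot {n} (n *ℕ n) p)
  j k : Fin n
  j = proj₁ (remQuot {n} n r)
  k = proj₂ (remQuot {n} n r)

tensor : ∀ {n} → Vector ℚ (cube n) → Tensor n
tensor x i j k = x (position i j k)

isNonZero : ℚ → Side
isNonZero q = Bool.not (does (q ℚ.≟ 0ℚ))

isNonZero⁺ : ∀ {q} → q ≢ 0ℚ → isNonZero q ≡ inside
isNonZero⁺ {q} q≢0 with q ℚ.≟ 0ℚ
... | yes q≡0 = contradiction q≡0 q≢0
... | no  _   = refl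

isNonZero⁻ : ∀ {q} → isNonZero q ≡ inside → q ≢ 0ℚ
isNonZero⁻ {q} nz with q ℚ.≟ 0ℚ
isNonZero⁻ () | yes _
... | no q≢0 = q≢0

support : ∀ {m} → Vector ℚ m → Subset m
support x = tabulateVec (isNonZero ∘ x)

∈-support⁺ : ∀ {m} (x : Vector ℚ m) p → x p ≢ 0ℚ → p ∈ support x
∈-support⁺ x p x[p]≢0 =
  lookup⇒[]= p (support x) (trans (lookup∘tabulate (isNonZero ∘ x) p) (isNonZero⁺ x[p]≢0))

tensorSupport : ∀ {n} → Tensor n → Subset (cube n)
tensorSupport A = concat (tabulateVec λ i → concat (tabulateVec λ j → support (A i j)))

lookup-tensorSupport : ∀ {n} (A : Tensor n) i j k →
  lookup (tensorSupport A) (position i j k) ≡ isNonZero (A i j k)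
lookup-tensorSupport {n} A i j k = begin
  lookup (tensorSupport A) (position i j k)                     ≡⟨ lookup-concat rows i (combine j k) ⟩
  lookup (lookup rows i) (combine j k)                          ≡⟨ cong (λ row → lookup row (combine j k)) (lookup∘tabulate _ i) ⟩
  lookup (concat (tabulateVec λ j → support (A i j))) (combine j k) ≡⟨ lookup-concat (tabulateVec λ j → support (A i j)) j k ⟩
  lookup (lookup (tabulateVec λ j → support (A i j)) j) k       ≡⟨ cong (λ row → lookup row k) (lookup∘tabulate _ j) ⟩
  lookup (support (A i j)) k                                    ≡⟨ lookup∘tabulate _ k ⟩
  isNonZero (A i j k)                                           ∎
  where
  open ≡-Reasoning
  rows : Vec (Subset (n *ℕ n)) n
  rows = tabulateVec λ i → concat (tabulateVec λ j → support (A i j))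

∈-tensorSupport⁺ : ∀ {n} (A : Tensor n) i j k → A i j k ≢ 0ℚ → position i j k ∈ tensorSupport A
∈-tensorSupport⁺ A i j k A≢0 =
  lookup⇒[]= _ _ (trans (lookup-tensorSupport A i j k) (isNonZero⁺ A≢0))

∈-tensorSupport⁻ : ∀ {n} (A : Tensor n) i j k → position i j k ∈ tensorSupport A → A i j k ≢ 0ℚ
∈-tensorSupport⁻ A i j k ∈A =
  isNonZero⁻ (trans (sym (lookup-tensorSupport A i j k)) ([]=⇒lookup ∈A))

-- LineStochastic n A unfolds to (entrywise nonnegativity) × LineSums 1ℚ A.
LineSums : ∀ {n} → ℚ → Tensor n → Set
LineSums {n} c X =
  (∀ j k → Σℚ n (λ i → X i j k) ≡ c) ×
  (∀ i k → Σℚ n (λ j → X i j k) ≡ c) ×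
  (∀ i j → Σℚ n (λ k → X i j k) ≡ c)

LineSums-linear : ∀ {n} {c d} {X Y : Tensor n} a b → LineSums c X → LineSums d Y →
  LineSums (a * c + b * d) (λ i j k → a * X i j k + b * Y i j k)
LineSums-linear {n} {X = X} {Y} a b (X₁ , X₂ , X₃) (Y₁ , Y₂ , Y₃) =
  (λ j k → combine-sums (λ i → X i j k) (λ i → Y i j k) (X₁ j k) (Y₁ j k)) ,
  (λ i k → combine-sums (λ j → X i j k) (λ j → Y i j k) (X₂ i k) (Y₂ i k)) ,
  (λ i j → combine-sums (X i j) (Y i j) (X₃ i j) (Y₃ i j))
  where
  combine-sums : ∀ {c d} f g → Σℚ n f ≡ c → Σℚ n g ≡ d → Σℚ n (λ i → a * f i + b * g i) ≡ a * c + b * d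
  combine-sums f g refl refl = Σℚ-linear n a b f g

lineSum : ∀ {n} → (Fin n → Fin (cube n)) → LinearForm (cube n)
lineSum {n} line = record
  { apply  = λ x → Σℚ n (x ∘ line)
  ; linear = λ a b x y → Σℚ-linear n a b (x ∘ line) (y ∘ line)
  }

grid : ∀ {a b} {A : Set} → (Fin a → Fin b → A) → List A
grid {b = b} g = tabulate (uncurry g ∘ remQuot b)

length-grid : ∀ {a b} {A : Set} (g : Fin a → Fin b → A) → length (grid g) ≡ a *ℕ b
length-grid g = length-tabulate _

grid⁻ : ∀ {a b} {A : Set} {P : A → Set} (g : Fin a → Fin b → A) →
  All P (grid g) → ∀ i j → P (g i j)
grid⁻ {P = P} g all i j = subst P (cong (uncurry g) (remQuot-combine i j)) (All.tabulate⁻ all (combine i j))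

sumAlongI sumAlongJ sumAlongK : ∀ {n} → Fin n → Fin n → LinearForm (cube n)
sumAlongI j k = lineSum (λ i → position i j k)
sumAlongJ i k = lineSum (λ j → position i j k)
sumAlongK i j = lineSum (λ k → position i j k)

sumAlongJ⁺ : ∀ {m} → Fin m → Fin (suc m) → LinearForm (cube (suc m))
sumAlongJ⁺ i k = sumAlongJ (suc i) k

sumAlongK⁺ : ∀ {m} → Fin m → Fin m → LinearForm (cube (suc m))
sumAlongK⁺ i j = sumAlongK (suc i) (suc j)

reducedLineSums : ∀ m → List (LinearForm (cube (suc m)))
reducedLineSums m = grid (sumAlongI {suc m}) ++ grid (sumAlongJ⁺ {m}) ++ grid (sumAlongK⁺ {m})

count-identity : ∀ m → (1 +ℕ m) *ℕ (1 +ℕ m) +ℕ (m *ℕ (1 +ℕ m) +ℕ m *ℕ m) ≡ 3 *ℕ (m *ℕ m) +ℕ 3 *ℕ m +ℕ 1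
count-identity = ℕ-solve-∀

square-identity : ∀ m → 3 *ℕ ((1 +ℕ m) *ℕ ((1 +ℕ m) *ℕ 1)) ≡ 3 *ℕ (m *ℕ m) +ℕ 3 *ℕ m +ℕ 3 *ℕ (1 +ℕ m)
square-identity = ℕ-solve-∀

-- Stated for an abstract n: at n = suc m the type checker would unfold the products.
reducedCount : ∀ {m n} → n ≡ 1 +ℕ m → n *ℕ n +ℕ (m *ℕ n +ℕ m *ℕ m) ≡ 3 *ℕ n ^ 2 ∸ 3 *ℕ n +ℕ 1
reducedCount {m} {n} n≡1+m = begin
  n *ℕ n +ℕ (m *ℕ n +ℕ m *ℕ m)      ≡⟨ subst (λ k → k *ℕ k +ℕ (m *ℕ k +ℕ m *ℕ m) ≡ t +ℕ 1) (sym n≡1+m) (count-identity m) ⟩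
  t +ℕ 1                             ≡⟨ cong (_+ℕ 1) (ℕ.m+n∸n≡m t (3 *ℕ n)) ⟨
  t +ℕ 3 *ℕ n ∸ 3 *ℕ n +ℕ 1         ≡⟨ cong (λ s → s ∸ 3 *ℕ n +ℕ 1) square ⟨
  3 *ℕ n ^ 2 ∸ 3 *ℕ n +ℕ 1          ∎
  where
  open ≡-Reasoning
  t : ℕ
  t = 3 *ℕ (m *ℕ m) +ℕ 3 *ℕ m
  square : 3 *ℕ (n *ℕ (n *ℕ 1)) ≡ t +ℕ 3 *ℕ n
  square = subst (λ k → 3 *ℕ (k *ℕ (k *ℕ 1)) ≡ t +ℕ 3 *ℕ k) (sym n≡1+m) (square-identity m)

length-reducedLineSums : ∀ m → length (reducedLineSums m) ≡ 3 *ℕ suc m ^ 2 ∸ 3 *ℕ suc m +ℕ 1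
length-reducedLineSums m = begin
  length (alongI ++ alongJ ++ alongK)                  ≡⟨ length-++ alongI ⟩
  length alongI +ℕ length (alongJ ++ alongK)           ≡⟨ cong (length alongI +ℕ_) (length-++ alongJ) ⟩
  length alongI +ℕ (length alongJ +ℕ length alongK)    ≡⟨ cong₂ _+ℕ_ (length-grid (sumAlongI {suc m}))
                                                            (cong₂ _+ℕ_ (length-grid (sumAlongJ⁺ {m})) (length-grid (sumAlongK⁺ {m}))) ⟩
  suc m *ℕ suc m +ℕ (m *ℕ suc m +ℕ m *ℕ m)            ≡⟨ reducedCount {m} refl ⟩
  3 *ℕ suc m ^ 2 ∸ 3 *ℕ suc m +ℕ 1                    ∎
  where
  open ≡-Reasoning
  alongI alongJ alongK : List (LinearForm (cube (suc m)))
  alongI = grid (sumAlongI {suc m})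
  alongJ = grid (sumAlongJ⁺ {m})
  alongK = grid (sumAlongK⁺ {m})

first-row-sum-zero : ∀ {m n} (f : Fin (suc m) → Fin n → ℚ) →
  (∀ j → Σℚ (suc m) (λ i → f i j) ≡ 0ℚ) → (∀ i → Σℚ n (f (suc i)) ≡ 0ℚ) → Σℚ n (f zero) ≡ 0ℚ
first-row-sum-zero {m} {n} f columns rows = begin
  Σℚ n (f zero)                                     ≡⟨ ℚ.+-identityʳ _ ⟨
  Σℚ n (f zero) + 0ℚ                                ≡⟨ cong (Σℚ n (f zero) +_) (Σℚ-zero m rows) ⟨
  Σℚ (suc m) (λ i → Σℚ n (f i))                    ≡⟨ Σℚ-comm (suc m) n f ⟩
  Σℚ n (λ j → Σℚ (suc m) (λ i → f i j))            ≡⟨ Σℚ-zero n columns ⟩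
  0ℚ                                                ∎
  where open ≡-Reasoning

reducedLineSums-complete : ∀ m (x : Vector ℚ (cube (suc m))) →
  Annihilates (reducedLineSums m) x → LineSums 0ℚ (tensor x)
reducedLineSums-complete m x vanish = sums₁ , sums₂ , sums₃
  where
  X : Tensor (suc m)
  X = tensor x
  blocks : Annihilates (grid (sumAlongI {suc m})) x × Annihilates (grid (sumAlongJ⁺ {m}) ++ grid (sumAlongK⁺ {m})) x
  blocks = All.++⁻ (grid (sumAlongI {suc m})) {grid (sumAlongJ⁺ {m}) ++ grid (sumAlongK⁺ {m})} vanish
  sums₁ : ∀ j k → Σℚ (suc m) (λ i → X i j k) ≡ 0ℚ
  sums₁ = grid⁻ (sumAlongI {suc m}) (proj₁ blocks)
  sums₂⁺ : ∀ i k → Σℚ (suc m) (λ j → X (suc i) j k) ≡ 0ℚ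
  sums₂⁺ = grid⁻ (sumAlongJ⁺ {m}) (proj₁ (All.++⁻ (grid (sumAlongJ⁺ {m})) (proj₂ blocks)))
  sums₃⁺⁺ : ∀ i j → Σℚ (suc m) (λ k → X (suc i) (suc j) k) ≡ 0ℚ
  sums₃⁺⁺ = grid⁻ (sumAlongK⁺ {m}) (proj₂ (All.++⁻ (grid (sumAlongJ⁺ {m})) (proj₂ blocks)))
  sums₂ : ∀ i k → Σℚ (suc m) (λ j → X i j k) ≡ 0ℚ
  sums₂ zero    k = first-row-sum-zero (λ i j → X i j k) (λ j → sums₁ j k) (λ i → sums₂⁺ i k)
  sums₂ (suc i) k = sums₂⁺ i k
  sums₃⁺ : ∀ i j → Σℚ (suc m) (λ k → X (suc i) j k) ≡ 0ℚ
  sums₃⁺ i zero    = first-row-sum-zero (X (suc i)) (sums₂ (suc i)) (sums₃⁺⁺ i)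
  sums₃⁺ i (suc j) = sums₃⁺⁺ i j
  sums₃ : ∀ i j → Σℚ (suc m) (λ k → X i j k) ≡ 0ℚ
  sums₃ zero    j = first-row-sum-zero (λ i k → X i j k) (λ k → sums₁ j k) (λ i → sums₃⁺ i j)
  sums₃ (suc i) j = sums₃⁺ i j

ForSmall : (ℚ → Set) → Set
ForSmall P = ∃[ ε ] 0ℚ <ℚ ε × ∀ δ → δ ≤ℚ ε → P δ

ForSmall-∀ : ∀ n {P : Fin n → ℚ → Set} → (∀ i → ForSmall (P i)) → ForSmall (λ δ → ∀ i → P i δ)
ForSmall-∀ zero    small = 1ℚ , ℚ.positive⁻¹ 1ℚ , λ _ _ ()
ForSmall-∀ (suc n) small =
  let ε₀ , ε₀>0 , P₀ = small zero
      ε₊ , ε₊>0 , P₊ = ForSmall-∀ n (small ∘ suc)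
  in ε₀ ⊓ ε₊ , ⊓-positive ε₀>0 ε₊>0 , λ where
       δ δ≤ zero    → P₀ δ (ℚ.≤-trans δ≤ (ℚ.p⊓q≤p ε₀ ε₊))
       δ δ≤ (suc i) → P₊ δ (ℚ.≤-trans δ≤ (ℚ.p⊓q≤q ε₀ ε₊)) i

slack : ∀ {a x} → 0ℚ ≤ℚ a → (x ≢ 0ℚ → a ≢ 0ℚ) → ForSmall (λ δ → δ * ℚ.∣ x ∣ ≤ℚ a)
slack {a} {x} a≥0 support with x ℚ.≟ 0ℚ
... | yes refl = 1ℚ , ℚ.positive⁻¹ 1ℚ , λ δ _ → subst (_≤ℚ a) (sym (ℚ.*-zeroʳ δ)) a≥0
... | no  x≢0  = a * 1/ ℚ.∣ x ∣ , ℚ.positive⁻¹ _ {{ℚ.pos*pos⇒pos a (1/ ℚ.∣ x ∣) {{ℚ.1/pos⇒pos ℚ.∣ x ∣}}}} ,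
  λ δ δ≤ → ℚ.≤-trans (ℚ.*-monoʳ-≤-nonNeg ℚ.∣ x ∣ {{ℚ.∣-∣-nonNeg x}} δ≤) (ℚ.≤-reflexive cancel)
  where
  instance
    _ : ℚ.NonNegative a
    _ = ℚ.nonNegative a≥0
    _ : ℚ.NonZero a
    _ = ℚ.≢-nonZero (support x≢0)
    _ : ℚ.Positive a
    _ = ℚ.nonNeg∧nonZero⇒pos a
    _ : ℚ.Positive ℚ.∣ x ∣
    _ = ℚ.nonNeg∧nonZero⇒pos ℚ.∣ x ∣ {{ℚ.∣-∣-nonNeg x}} {{ℚ.≢-nonZero (x≢0 ∘ ℚ.∣p∣≡0⇒p≡0 x)}}
    _ : ℚ.NonZero ℚ.∣ x ∣
    _ = ℚ.pos⇒nonZero ℚ.∣ x ∣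
  cancel : a * 1/ ℚ.∣ x ∣ * ℚ.∣ x ∣ ≡ a
  cancel = trans (ℚ.*-assoc a _ _) (trans (cong (a *_) (ℚ.*-inverseˡ ℚ.∣ x ∣)) (ℚ.*-identityʳ a))

perturbation-lineStochastic : ∀ {n} {A X : Tensor n} d → LineStochastic n A → LineSums 0ℚ X →
  (∀ i j k → ℚ.∣ d ∣ * ℚ.∣ X i j k ∣ ≤ℚ A i j k) →
  LineStochastic n (λ i j k → 1ℚ * A i j k + d * X i j k)
perturbation-lineStochastic {A = A} {X} d (A≥0 , A-sums) X-sums small =
  nonnegative , subst (λ c → LineSums c (λ i j k → 1ℚ * A i j k + d * X i j k)) total
                  (LineSums-linear 1ℚ d A-sums X-sums)
  where
  total : 1ℚ * 1ℚ + d * 0ℚ ≡ 1ℚ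
  total = trans (cong₂ _+_ (ℚ.*-identityˡ 1ℚ) (ℚ.*-zeroʳ d)) (ℚ.+-identityʳ 1ℚ)
  nonnegative : ∀ i j k → 0ℚ ≤ℚ 1ℚ * A i j k + d * X i j k
  nonnegative i j k = subst (λ a → 0ℚ ≤ℚ a + d * X i j k) (sym (ℚ.*-identityˡ (A i j k)))
    (∣y∣≤a⇒0≤a+y (subst (_≤ℚ A i j k) (sym (ℚ.∣p*q∣≡∣p∣*∣q∣ d (X i j k))) (small i j k)))

vertex-rigid : ∀ {n} {A X : Tensor n} → IsVertex n A → LineSums 0ℚ X →
  (∀ i j k → X i j k ≢ 0ℚ → A i j k ≢ 0ℚ) → ∀ i j k → X i j k ≡ 0ℚ
vertex-rigid {n} {A} {X} (stochastic@(A≥0 , _) , extreme) X-sums X⊆A i j k =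
  p*q≡0⇒q≡0 (λ ε≡0 → ℚ.<⇒≢ ε>0 (sym ε≡0)) (εX≡0 i j k)
  where
  small : ForSmall (λ δ → ∀ i j k → δ * ℚ.∣ X i j k ∣ ≤ℚ A i j k)
  small = ForSmall-∀ n λ i → ForSmall-∀ n λ j → ForSmall-∀ n λ k → slack (A≥0 i j k) (X⊆A i j k)
  ε : ℚ
  ε = proj₁ small
  ε>0 : 0ℚ <ℚ ε
  ε>0 = proj₁ (proj₂ small)
  ∣ε∣≡ε : ℚ.∣ ε ∣ ≡ ε
  ∣ε∣≡ε = ℚ.0≤p⇒∣p∣≡p (ℚ.<⇒≤ ε>0)
  bound : ∀ {e} → ℚ.∣ e ∣ ≡ ε → ∀ i j k → ℚ.∣ e ∣ * ℚ.∣ X i j k ∣ ≤ℚ A i j k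
  bound {e} ∣e∣≡ε i j k =
    subst (λ t → t * ℚ.∣ X i j k ∣ ≤ℚ A i j k) (sym ∣e∣≡ε) (proj₂ (proj₂ small) ε ℚ.≤-refl i j k)
  B₊ B₋ : Tensor n
  B₊ i j k = 1ℚ * A i j k + ε * X i j k
  B₋ i j k = 1ℚ * A i j k + (- ε) * X i j k
  midpoint : A ≐ (λ i j k → ½ * B₊ i j k + (1ℚ ℚ.- ½) * B₋ i j k)
  midpoint i j k = average (A i j k) ε (X i j k)
    where
    average : ∀ a e x → a ≡ ½ * (1ℚ * a + e * x) + (1ℚ ℚ.- ½) * (1ℚ * a + (- e) * x)
    average = solve-∀ ℚ-ring
  B₊≐A : B₊ ≐ A
  B₊≐A = proj₁ (extreme B₊ B₋ ½
    (perturbation-lineStochastic ε stochastic X-sums (bound ∣ε∣≡ε))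
    (perturbation-lineStochastic (- ε) stochastic X-sums (bound (trans (ℚ.∣-p∣≡∣p∣ ε) ∣ε∣≡ε)))
    (from-yes (0ℚ ℚ.<? ½)) (from-yes (½ ℚ.<? 1ℚ)) midpoint)
  εX≡0 : ∀ i j k → ε * X i j k ≡ 0ℚ
  εX≡0 i j k = begin
    ε * X i j k                 ≡⟨ difference (A i j k) ε (X i j k) ⟩
    B₊ i j k ℚ.- A i j k        ≡⟨ cong (ℚ._- A i j k) (B₊≐A i j k) ⟩
    A i j k ℚ.- A i j k         ≡⟨ ℚ.+-inverseʳ (A i j k) ⟩
    0ℚ                          ∎
    where
    open ≡-Reasoning
    difference : ∀ a e x → e * x ≡ (1ℚ * a + e * x) ℚ.- a
    difference = solve-∀ ℚ-ring

vertex-support-minimal : ∀ {n} {A B : Tensor n} → IsVertex n A → LineStochastic n B →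
  (∀ i j k → B i j k ≢ 0ℚ → A i j k ≢ 0ℚ) → A ≐ B
vertex-support-minimal {n} {A} {B} vertex@((_ , A-sums) , _) (_ , B-sums) B⊆A i j k = begin
  A i j k                 ≡⟨ split (A i j k) (B i j k) ⟩
  D i j k + B i j k       ≡⟨ cong (_+ B i j k) (D≡0 i j k) ⟩
  0ℚ + B i j k            ≡⟨ ℚ.+-identityˡ (B i j k) ⟩
  B i j k                 ∎
  where
  open ≡-Reasoning
  D : Tensor n
  D i j k = 1ℚ * A i j k + (- 1ℚ) * B i j k
  split : ∀ a b → a ≡ (1ℚ * a + (- 1ℚ) * b) + b
  split = solve-∀ ℚ-ring
  D⊆A : ∀ i j k → D i j k ≢ 0ℚ → A i j k ≢ 0ℚ
  D⊆A i j k D≢0 A≡0 with B i j k ℚ.≟ 0ℚ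
  ... | yes B≡0 = D≢0 (begin
    1ℚ * A i j k + (- 1ℚ) * B i j k   ≡⟨ cong₂ (λ a b → 1ℚ * a + (- 1ℚ) * b) A≡0 B≡0 ⟩
    1ℚ * 0ℚ + (- 1ℚ) * 0ℚ             ≡⟨ a*0+b*0≡0 1ℚ (- 1ℚ) ⟩
    0ℚ                                ∎)
  ... | no  B≢0 = B⊆A i j k B≢0 A≡0
  total : 1ℚ * 1ℚ + (- 1ℚ) * 1ℚ ≡ 0ℚ
  total = trans (cong₂ _+_ (ℚ.*-identityˡ 1ℚ) (ℚ.*-identityʳ (- 1ℚ))) (ℚ.+-inverseʳ 1ℚ)
  D≡0 : ∀ i j k → D i j k ≡ 0ℚ
  D≡0 = vertex-rigid vertex (subst (λ c → LineSums c D) total (LineSums-linear 1ℚ (- 1ℚ) A-sums B-sums)) D⊆A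

tensorSupport-injective : ∀ {n} {A B : Tensor n} → IsVertex n A → IsVertex n B →
  tensorSupport A ≡ tensorSupport B → A ≐ B
tensorSupport-injective {A = A} {B} vA vB same = vertex-support-minimal vA (proj₁ vB) λ i j k B≢0 →
  ∈-tensorSupport⁻ A i j k (subst (position i j k ∈_) (sym same) (∈-tensorSupport⁺ B i j k B≢0))

lineStochastic-support-lower : ∀ {n} {A : Tensor n} → LineStochastic n A → n ^ 2 ≤ ∣ tensorSupport A ∣
lineStochastic-support-lower {n} {A} (_ , _ , _ , sums) =
  ∣concat∣-lower _ λ i → ∣concat∣-lower _ λ j → line-nonempty i j
  where
  line-nonempty : ∀ i j → 1 ≤ ∣ support (A i j) ∣
  line-nonempty i j =
    let k , A≢0 = Σℚ≢0⇒nonzero-term n (λ Σ≡0 → ℚ.1≢0 (trans (sym (sums i j)) Σ≡0))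
    in x∈p⇒∣p∣>0 (∈-support⁺ (A i j) k A≢0)

vertex-support-upper : ∀ {n} {A : Tensor n} → 1 ≤ n → IsVertex n A →
  ∣ tensorSupport A ∣ ≤ 3 *ℕ n ^ 2 ∸ 3 *ℕ n +ℕ 1
vertex-support-upper {suc m} {A} (s≤s z≤n) vertex =
  subst (∣ tensorSupport A ∣ ≤_) (length-reducedLineSums m) (ℕ.≮⇒≥ too-large)
  where
  too-large : ¬ (length (reducedLineSums m) < ∣ tensorSupport A ∣)
  too-large forms<support =
    let x , x⊆A , (p , x[p]≢0) , solves = nontrivial-solution (reducedLineSums m) (tensorSupport A) forms<support
        i , j , k , ijk≡p = position-surjective {suc m} p
        X≡0 = vertex-rigid {X = tensor {suc m} x} vertex (reducedLineSums-complete m x solves)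
                (λ i j k X≢0 → ∈-tensorSupport⁻ A i j k (x⊆A (position i j k) X≢0))
    in x[p]≢0 (subst (λ q → x q ≡ 0ℚ) ijk≡p (X≡0 i j k))

mainTheorem3 : (n : ℕ) → 1 ≤ n → (vs : List (Tensor n)) →
    All (IsVertex n) vs → AllPairs (λ A B → ¬ (A ≐ B)) vs →
    length vs ≤ vertexBound n
mainTheorem3 n 1≤n vs vertices distinct = begin
  length vs                                   ≡⟨ length-map tensorSupport vs ⟨
  length (map tensorSupport vs)               ≤⟨ unique-subsets-sized-within (n ^ 2) R sizes supports-unique ⟩
  sumFromTo (n ^ 2) R (cube n C_)             ≡⟨ cong (λ N → sumFromTo (n ^ 2) R (N C_)) cube≡n^3 ⟩
  vertexBound n                               ∎
  where
  open ℕ.≤-Reasoning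
  R : ℕ
  R = 3 *ℕ n ^ 2 ∸ 3 *ℕ n +ℕ 1
  cube≡n^3 : cube n ≡ n ^ 3
  cube≡n^3 = cong (λ t → n *ℕ (n *ℕ t)) (sym (ℕ.*-identityʳ n))
  sizes : All (λ s → n ^ 2 ≤ ∣ s ∣ × ∣ s ∣ ≤ R) (map tensorSupport vs)
  sizes = All.map⁺ (All.map (λ v → lineStochastic-support-lower (proj₁ v) , vertex-support-upper 1≤n v) vertices)
  supports-unique : Unique (map tensorSupport vs)
  supports-unique = AllPairs.map⁺ (AllPairs-map-under-All
    (λ vA vB A≢B same → A≢B (tensorSupport-injective vA vB same)) vertices distinct)
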